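{- Let $k\ge 2$, let $G$ be a graph with minimum degree at least $k$, and let $L=(P,C)$ be an optimal lollipop of $G$ with $C=c_1\dots c_tc_1$ and $c_1$ the common vertex of $P$ and $C$. Then $C$ contains at least $k$ active vertices. Moreover, if $d_C(c_1)<k$, then $C$ contains at least $k+1$ active vertices.
   Context: All graphs are finite and simple. A path is a sequence $p_1\dots p_s$ of distinct vertices with consecutive vertices adjacent; a cycle is a sequence $c_1\dots c_t c_1$ ($t\ge 3$) of distinct vertices with consecutive vertices (indices mod $t$) adjacent; its length is its number of edges. A chord of a path/cycle is an edge of $G$ between two of its vertices that is not one of its edges. For a path $Q$ and vertices $a,b$ on $Q$, $aQb$ denotes the subpath of $Q$ from $a$ to $b$. $d_C(v)=|N_G(v)\cap V(C)|$. A lollipop in $G$ is a pair $L=(P,C)$ where $P=p_1\dots p_s$ ($s\geq 1$) is a path, $C=c_1\dots c_tc_1$ ($t\geq 3$) is a cycle, $p_s=c_1$ and $V(P)\cap V(C)=\{c_1\}$; $V(L)=V(P)\cup V(C)$. $L=(P,C)$ is optimal if no lollipop $L'$ satisfies $V(L)\subsetneq V(L')$, and no lollipop $L'=(P',C')$ with $V(L')=V(L)$ has $C'$ longer than $C$. Sets $\mathcal S_i$ of Hamiltonian paths of $G[V(C)]$ starting at $c_1$: $\mathcal S_1=\{c_1c_2\dots c_t,\ c_1c_tc_{t-1}\dots c_2\}$; for $i\ge 1$, $\mathcal S_{i+1}$ is the set of all paths obtained as follows: for each $Q=c_1\dots u\in\mathcal S_i$ and each vertex $v$ such that $uv$ is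 a chord of $Q$, let $w$ be the neighbor of $v$ on $vQu$; if $vw$ is an edge of $C$, then $c_1QvuQw$ is put in $\mathcal S_{i+1}$. A path is active if it belongs to $\mathcal S_i$ for some $i\ge 1$. A vertex $u\neq c_1$ is active if it is the end (other than $c_1$) of an active path; $c_1$ is not active. -}

module Defs where

open import Level using (0ℓ)
open import Data.Nat using (ℕ; suc; _≤_; _<_)
open import Data.Fin using (Fin)
open import Data.List using (List; []; _∷_; _++_; [_]; length; filter; reverse)
open import Data.List.Membership.Propositional using (_∈_; _∉_)
open import Data.List.Relation.Unary.Unique.Propositional using (Unique)
open import Data.List.Relation.Unary.Linked using (Linked)
open import Data.List.Relation.Unary.All using (All)
open import Data.Product using (Σ; ∃; _×_; _,_)
open import Data.Sum using (_⊎_)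
open import Data.Empty using (⊥)
open import Relation.Nullary using (¬_)
open import Relation.Unary using (Decidable)
open import Relation.Binary.PropositionalEquality using (_≡_; _≢_)
open import Data.Vec.Functional using ()
open import Data.List using () renaming (tabulate to tab)

record Graph : Set₁ where
  field
    n     : ℕ
    E     : Fin n → Fin n → Set
    E?    : ∀ v → Decidable (E v)
    sym   : ∀ {u v} → E u v → E v u
    irrefl : ∀ {v} → ¬ E v v

module _ (G : Graph) where
  open Graph G

  V : Set
  V = Fin n

  allV : List V
  allV = tab (λ i → i)

  deg : V → ℕ
  deg v = length (filter (E? v) allV)

  degIn : V → List V → ℕ
  degIn v S = length (filter (E? v) S)

  MinDegAtLeast : ℕ → Set
  MinDegAtLeast k = ∀ v → k ≤ deg v

  IsPath : List V → Set
  IsPath l = Unique l × Linked E l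

  -- the cycle c₁ c₂ … c_t c₁ given by c₁ and [c₂,…,c_t]
  IsCycle : V → List V → Set
  IsCycle c₁ r = 3 ≤ length (c₁ ∷ r) × Unique (c₁ ∷ r) × Linked E (c₁ ∷ r ++ [ c₁ ])

  Consec : List V → V → V → Set
  Consec l x y = Σ (List V) λ A → Σ (List V) λ B → l ≡ A ++ x ∷ y ∷ B

  CycEdge : V → List V → V → V → Set
  CycEdge c₁ r x y = Consec (c₁ ∷ r ++ [ c₁ ]) x y ⊎ Consec (c₁ ∷ r ++ [ c₁ ]) y x

  -- A lollipop (P, C): P = pre ++ [c₁], C = c₁ ∷ rest (closed back to c₁),
  -- V(P) ∩ V(C) = {c₁}.
  record Lollipop : Set where
    field
      pre   : List V
      c₁    : V
      rest  : List V
      isPathP  : IsPath (pre ++ [ c₁ ])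
      isCycleC : IsCycle c₁ rest
      disjoint : ∀ x → x ∈ pre → x ∉ (c₁ ∷ rest)

    cyc : List V
    cyc = c₁ ∷ rest

    cycLen : ℕ
    cycLen = length cyc

  _∈L_ : V → Lollipop → Set
  x ∈L L = x ∈ Lollipop.pre L ⊎ x ∈ Lollipop.cyc L

  Optimal : Lollipop → Set
  Optimal L =
    (∀ (L' : Lollipop) → (∀ x → x ∈L L → x ∈L L') → ¬ (∃ λ x → x ∈L L' × ¬ (x ∈L L)))
    × (∀ (L' : Lollipop) → (∀ x → x ∈L L → x ∈L L') → (∀ x → x ∈L L' → x ∈L L)
         → Lollipop.cycLen L' ≤ Lollipop.cycLen L)

  module _ (c₁ : V) (r : List V) where
    -- Active paths (union over i of the sets S_i), for the cycle c₁ ∷ r.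
    -- Step: Q = A ++ v ∷ w ∷ M ++ [u]; uv is a chord of Q (u,v not consecutive
    -- on Q since w ∷ M ++ [u] has length ≥ 2), w the neighbour of v on vQu,
    -- vw an edge of C; new path c₁QvuQw = A ++ v ∷ reverse (w ∷ M ++ [u]).
    data ActivePath : List V → Set where
      base₁ : ActivePath (c₁ ∷ r)
      base₂ : ActivePath (c₁ ∷ reverse r)
      step  : ∀ A v w M u →
              ActivePath (A ++ v ∷ w ∷ M ++ [ u ]) →
              E u v →
              CycEdge c₁ r v w →
              ActivePath (A ++ v ∷ reverse (w ∷ M ++ [ u ]))

    ActiveVertex : V → Set
    ActiveVertex u = u ≢ c₁ × (Σ (List V) λ Q → ActivePath (Q ++ [ u ]))

    AtLeastActive : ℕ → Set
    AtLeastActive m = Σ (List V) λ S →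
      m ≤ length S × Unique S × All (λ x → x ∈ (c₁ ∷ r)) S × All ActiveVertex S

-- Optimality forces every neighbour of the end of a Hamiltonian path of C starting at c₁ to lie on C: a
-- neighbour outside the lollipop would make the path grow into a lollipop with more vertices (minimum degree
-- at least 2 lets every path grow into a lollipop), and a neighbour on P would close a longer cycle on the same
-- vertices. Rotating the active path c₁ c₂ … cₜ at each of the at least k neighbours of cₜ makes the successor
-- of that neighbour an active vertex. If d_C(c₁) < k, one such successor y is not adjacent to c₁; rotating at
-- it gives an active path ending at y all of whose consecutive pairs are edges of C except at the rotation.
-- The successors of the neighbours of y on it are active as before, none of them is c₂, which follows c₁, and
-- c₂ is active as the end of c₁ cₜ … c₂.
module Submission where

open import Defs

open import Data.Bool using (if_then_else_)
open import Data.Empty using (⊥-elim)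
open import Data.Fin.Properties using (_≟_)
open import Data.Nat using (ℕ; zero; suc; _+_; _≤_; _<_; z≤n; s≤s)
open import Data.Nat.Properties using (≤-trans; <⇒≱; +-suc; m≤m+n; m≤n+m; n≤1+n; module ≤-Reasoning)
open import Data.List using (List; []; _∷_; _++_; [_]; length; filter; reverse; reverseAcc)
open import Data.List.Properties
  using (++-assoc; ++-identityʳ; ++-conicalʳ; ∷-injectiveˡ; ∷-injectiveʳ; ∷ʳ-injectiveʳ; reverse-++; unfold-reverse;
         reverse-involutive; length-++; length-reverse; length-tabulate; filter-++; filter-reject)
open import Data.List.Reverse using (reverseView; []; _∶_∶ʳ_)
open import Data.List.Membership.Propositional using (_∈_; _∉_; find)
open import Data.List.Membership.Propositional.Properties
  using (∈-∃++; ∈-++⁺ˡ; ∈-++⁺ʳ; ∈-++⁻; ∈-filter⁺; ∈-filter⁻; ∈-tabulate⁺)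
open import Data.List.Relation.Binary.Subset.Propositional using (_⊆_)
open import Data.List.Relation.Binary.Disjoint.Propositional using (Disjoint)
open import Data.List.Relation.Binary.Permutation.Propositional using (_↭_; ↭-refl; ↭-sym; ↭-trans; ↭-prep; ↭⇒↭ₛ)
open import Data.List.Relation.Binary.Permutation.Propositional.Properties
  using (∈-resp-↭; ↭-length; ↭-reverse; shift; ++⁺ˡ)
import Data.List.Relation.Binary.Permutation.Setoid.Properties as PermutationSetoid
open import Data.List.Relation.Unary.Any using (here; there)
open import Data.List.Relation.Unary.Any.Properties using (reverse⁺)
open import Data.List.Relation.Unary.All as All using (All; []; _∷_; all?)
open import Data.List.Relation.Unary.All.Properties using (¬Any⇒All¬; All¬⇒¬Any; ¬All⇒Any¬; ++⁻ˡ; ++⁻ʳ)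
open import Data.List.Relation.Unary.AllPairs using ([]; _∷_)
open import Data.List.Relation.Unary.Unique.Propositional using (Unique)
open import Data.List.Relation.Unary.Unique.Propositional.Properties as Unique
  using (tabulate⁺; filter⁺; Unique[x∷xs]⇒x∉xs)
open import Data.List.Relation.Unary.Linked as Linked using (Linked; []; [-]; _∷_)
open import Data.Product using (Σ; ∃; ∃₂; _×_; _,_; proj₁; proj₂; map₂)
open import Data.Sum using (_⊎_; inj₁; inj₂; [_,_]′)
open import Function using (id; _∘_; case_of_)
open import Relation.Binary.Definitions using (Symmetric)
open import Relation.Binary.PropositionalEquality
  using (_≡_; _≢_; refl; sym; trans; cong; subst; setoid; module ≡-Reasoning)
open import Relation.Nullary using (¬_; yes; no; does)
open import Relation.Unary using (Decidable)

module _ {A : Set} where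

  Unique-∷ : ∀ {x : A} {xs} → x ∉ xs → Unique xs → Unique (x ∷ xs)
  Unique-∷ {xs = xs} x∉xs u = ¬Any⇒All¬ xs x∉xs ∷ u

  Unique-++⁻ˡ : ∀ (xs : List A) {ys} → Unique (xs ++ ys) → Unique xs
  Unique-++⁻ˡ []       _        = []
  Unique-++⁻ˡ (x ∷ xs) (px ∷ u) = ++⁻ˡ xs px ∷ Unique-++⁻ˡ xs u

  Unique-++⁻ʳ : ∀ (xs : List A) {ys} → Unique (xs ++ ys) → Unique ys
  Unique-++⁻ʳ []       u       = u
  Unique-++⁻ʳ (x ∷ xs) (_ ∷ u) = Unique-++⁻ʳ xs u

  Unique-++⇒Disjoint : ∀ (xs : List A) {ys} → Unique (xs ++ ys) → Disjoint xs ys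
  Unique-++⇒Disjoint (x ∷ xs) (px ∷ _) (here refl  , v∈ys) = All¬⇒¬Any (++⁻ʳ xs px) v∈ys
  Unique-++⇒Disjoint (x ∷ xs) (_ ∷ u)  (there v∈xs , v∈ys) = Unique-++⇒Disjoint xs u (v∈xs , v∈ys)

  Unique-resp-↭ : ∀ {xs ys : List A} → xs ↭ ys → Unique xs → Unique ys
  Unique-resp-↭ p = PermutationSetoid.Unique-resp-↭ (setoid A) (↭⇒↭ₛ p)

  Unique-reverse : ∀ {xs : List A} → Unique xs → Unique (reverse xs)
  Unique-reverse {xs} = Unique-resp-↭ (↭-sym (↭-reverse xs))

  Unique-⊆⇒length≤ : ∀ {xs ys : List A} → Unique xs → xs ⊆ ys → length xs ≤ length ys
  Unique-⊆⇒length≤ {[]}     _         _   = z≤n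
  Unique-⊆⇒length≤ {x ∷ xs} (x∉ ∷ u) xs⊆ with ∈-∃++ (xs⊆ (here refl))
  ... | ys₁ , ys₂ , refl =
    subst (suc (length xs) ≤_) (sym (↭-length (shift x ys₁ ys₂)))
      (s≤s (Unique-⊆⇒length≤ u xs⊆ys₁++ys₂))
    where
    xs⊆ys₁++ys₂ : xs ⊆ ys₁ ++ ys₂
    xs⊆ys₁++ys₂ {z} z∈xs with ∈-resp-↭ (shift x ys₁ ys₂) (xs⊆ (there z∈xs))
    ... | here refl = ⊥-elim (All¬⇒¬Any x∉ z∈xs)
    ... | there z∈  = z∈

  distinct-pair : ∀ {xs : List A} → Unique xs → 2 ≤ length xs → ∃₂ λ a b → a ∈ xs × b ∈ xs × a ≢ b
  distinct-pair {_ ∷ []}    _                 (s≤s ())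
  distinct-pair {a ∷ b ∷ _} ((a≢b ∷ _) ∷ _) _        = a , b , here refl , there (here refl) , a≢b

module _ {A : Set} {R : A → A → Set} where

  Linked-++⁻ʳ : ∀ (xs : List A) {ys} → Linked R (xs ++ ys) → Linked R ys
  Linked-++⁻ʳ []       l = l
  Linked-++⁻ʳ (x ∷ xs) l = Linked-++⁻ʳ xs (Linked.tail l)

  Linked-++⁻ˡ : ∀ (xs : List A) {ys} → Linked R (xs ++ ys) → Linked R xs
  Linked-++⁻ˡ []            _       = []
  Linked-++⁻ˡ (x ∷ [])      _       = [-]
  Linked-++⁻ˡ (x ∷ x′ ∷ xs) (r ∷ l) = r ∷ Linked-++⁻ˡ (x′ ∷ xs) l

  Linked-++-∷⁺ : ∀ (xs : List A) {y ys} → Linked R (xs ++ [ y ]) → Linked R (y ∷ ys) → Linked R (xs ++ y ∷ ys)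
  Linked-++-∷⁺ []            _       l = l
  Linked-++-∷⁺ (x ∷ [])      (r ∷ _) l = r ∷ l
  Linked-++-∷⁺ (x ∷ x′ ∷ xs) (r ∷ l′) l = r ∷ Linked-++-∷⁺ (x′ ∷ xs) l′ l

  Linked-∷ʳ : ∀ (xs : List A) {y z} → Linked R (xs ++ [ y ]) → R y z → Linked R ((xs ++ [ y ]) ++ [ z ])
  Linked-∷ʳ xs {y} {z} l r = subst (Linked R) (sym (++-assoc xs [ y ] [ z ])) (Linked-++-∷⁺ xs l (r ∷ [-]))

  module _ (R-sym : Symmetric R) where

    -- reverse (x ∷ xs) unfolds definitionally to an accumulating fold starting from [ x ].
    Linked-reverseAcc : ∀ {x acc} (xs : List A) → Linked R (x ∷ xs) → Linked R (x ∷ acc) →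
                        Linked R (reverseAcc (x ∷ acc) xs)
    Linked-reverseAcc []       _       la = la
    Linked-reverseAcc (y ∷ xs) (r ∷ l) la = Linked-reverseAcc xs l (R-sym r ∷ la)

    Linked-reverse : ∀ {xs : List A} → Linked R xs → Linked R (reverse xs)
    Linked-reverse {[]}     _ = []
    Linked-reverse {x ∷ xs} l = Linked-reverseAcc xs l [-]

module _ {A : Set} where

  ∷-unsnoc : ∀ (x : A) xs → ∃₂ λ I u → x ∷ xs ≡ I ++ [ u ]
  ∷-unsnoc x []       = [] , x , refl
  ∷-unsnoc x (y ∷ xs) with ∷-unsnoc y xs
  ... | I , u , eq = x ∷ I , u , cong (x ∷_) eq

  common-head : ∀ (xs : List A) {x ys ys′} →
                ∃ λ h → ∃₂ λ zs zs′ → xs ++ x ∷ ys ≡ h ∷ zs × xs ++ x ∷ ys′ ≡ h ∷ zs′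
  common-head []       = _ , _ , _ , refl , refl
  common-head (x ∷ xs) = x , _ , _ , refl , refl

  reverse-++-∷ : ∀ (xs : List A) y ys → reverse (xs ++ y ∷ ys) ≡ reverse ys ++ y ∷ reverse xs
  reverse-++-∷ xs y ys = begin
    reverse (xs ++ y ∷ ys)              ≡⟨ reverse-++ xs (y ∷ ys) ⟩
    reverse (y ∷ ys) ++ reverse xs      ≡⟨ cong (_++ reverse xs) (unfold-reverse y ys) ⟩
    (reverse ys ++ [ y ]) ++ reverse xs ≡⟨ ++-assoc (reverse ys) [ y ] (reverse xs) ⟩
    reverse ys ++ y ∷ reverse xs        ∎
    where open ≡-Reasoning

  -- Definitionally equal to Defs' Consec, which is only available on graph vertices.
  Consecutive : List A → A → A → Set
  Consecutive l x y = Σ (List A) λ B → Σ (List A) λ C → l ≡ B ++ x ∷ y ∷ C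

  Consecutive-++⁺ʳ : ∀ {xs} ys {z w : A} → Consecutive xs z w → Consecutive (xs ++ ys) z w
  Consecutive-++⁺ʳ ys (B , C , refl) = B , C ++ ys , ++-assoc B _ ys

  Consecutive-++⁺ˡ : ∀ xs {ys} {z w : A} → Consecutive ys z w → Consecutive (xs ++ ys) z w
  Consecutive-++⁺ˡ xs (B , C , refl) = xs ++ B , C , sym (++-assoc xs B _)

  Consecutive-reverse⁻ : ∀ xs {z w : A} → Consecutive (reverse xs) z w → Consecutive xs w z
  Consecutive-reverse⁻ xs {z} {w} (B , C , eq) = reverse C , reverse B , (begin
    xs                                 ≡⟨ sym (reverse-involutive xs) ⟩
    reverse (reverse xs)               ≡⟨ cong reverse eq ⟩
    reverse (B ++ z ∷ w ∷ C)           ≡⟨ reverse-++-∷ B z (w ∷ C) ⟩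
    reverse (w ∷ C) ++ z ∷ reverse B   ≡⟨ cong (_++ z ∷ reverse B) (unfold-reverse w C) ⟩
    (reverse C ++ [ w ]) ++ z ∷ reverse B ≡⟨ ++-assoc (reverse C) [ w ] _ ⟩
    reverse C ++ w ∷ z ∷ reverse B     ∎)
    where open ≡-Reasoning

  Consecutive-++-∷⁻ : ∀ xs {y ys} {z w : A} → Consecutive (xs ++ y ∷ ys) z w →
                      Consecutive xs z w ⊎ w ≡ y ⊎ Consecutive (y ∷ ys) z w
  Consecutive-++-∷⁻ []            c                = inj₂ (inj₂ c)
  Consecutive-++-∷⁻ (x ∷ [])      ([] , _ , refl)  = inj₂ (inj₁ refl)
  Consecutive-++-∷⁻ (x ∷ x′ ∷ xs) ([] , _ , refl)  = inj₁ ([] , xs , refl)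
  Consecutive-++-∷⁻ (x ∷ xs)      (_ ∷ B , C , eq) with Consecutive-++-∷⁻ xs (B , C , ∷-injectiveʳ eq)
  ... | inj₁ (B′ , C′ , eq′) = inj₁ (x ∷ B′ , C′ , cong (x ∷_) eq′)
  ... | inj₂ c               = inj₂ c

  Consecutive-∷ʳ⁻ : ∀ D {z w : A} F I {e} → D ++ z ∷ w ∷ F ≡ I ++ [ e ] →
                    w ≡ e ⊎ ∃ λ F′ → F ≡ F′ ++ [ e ]
  Consecutive-∷ʳ⁻ D {z} {w} F I eq with reverseView F
  ... | [] = inj₁ (∷ʳ-injectiveʳ (D ++ [ z ]) I (trans (++-assoc D [ z ] [ w ]) eq))
  ... | F′ ∶ _ ∶ʳ f =
    inj₂ (F′ , cong (λ x → F′ ++ [ x ]) (∷ʳ-injectiveʳ (D ++ z ∷ w ∷ F′) I (trans (++-assoc D _ [ f ]) eq)))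

module _ {A : Set} {P : A → Set} (P? : Decidable P) where

  followers : List A → List A
  followers []           = []
  followers (_ ∷ [])     = []
  followers (a ∷ b ∷ xs) = if does (P? a) then b ∷ followers (b ∷ xs) else followers (b ∷ xs)

  length-followers : ∀ xs e → length (followers (xs ++ [ e ])) ≡ length (filter P? xs)
  length-followers []           e = refl
  length-followers (a ∷ [])     e with P? a
  ... | yes _ = refl
  ... | no  _ = refl
  length-followers (a ∷ b ∷ xs) e with P? a | length-followers (b ∷ xs) e
  ... | yes _ | ih = cong suc ih
  ... | no  _ | ih = ih

  followers-⊆-tail : ∀ a xs → followers (a ∷ xs) ⊆ xs
  followers-⊆-tail a (b ∷ xs) w∈ with P? a | followers-⊆-tail b xs
  followers-⊆-tail a (b ∷ xs) (here refl) | yes _ | _  = here refl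
  followers-⊆-tail a (b ∷ xs) (there w∈)  | yes _ | ih = there (ih w∈)
  followers-⊆-tail a (b ∷ xs) w∈          | no  _ | ih = there (ih w∈)

  ∈-followers⁻ : ∀ xs {w} → w ∈ followers xs → ∃ λ v → P v × Consecutive xs v w
  ∈-followers⁻ (a ∷ b ∷ xs) w∈ with P? a | ∈-followers⁻ (b ∷ xs)
  ∈-followers⁻ (a ∷ b ∷ xs) (here refl) | yes pa | _  = a , pa , [] , xs , refl
  ∈-followers⁻ (a ∷ b ∷ xs) (there w∈)  | yes _  | ih = map₂ (map₂ (Consecutive-++⁺ˡ [ a ])) (ih w∈)
  ∈-followers⁻ (a ∷ b ∷ xs) w∈          | no  _  | ih = map₂ (map₂ (Consecutive-++⁺ˡ [ a ])) (ih w∈)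

  followers-Unique : ∀ xs → Unique xs → Unique (followers xs)
  followers-Unique []           _ = []
  followers-Unique (_ ∷ [])     _ = []
  followers-Unique (a ∷ b ∷ xs) (_ ∷ u@(b∉xs ∷ _)) with P? a | followers-Unique (b ∷ xs) u
  ... | yes _ | ih = Unique-∷ (All¬⇒¬Any b∉xs ∘ followers-⊆-tail b xs) ih
  ... | no  _ | ih = ih

  ∉-followers : ∀ {a b xs} → ¬ P a → Unique (a ∷ b ∷ xs) → b ∉ followers (a ∷ b ∷ xs)
  ∉-followers {a} {b} {xs} ¬pa (_ ∷ b∉xs ∷ _) b∈ with P? a
  ... | yes pa = ¬pa pa
  ... | no  _  = All¬⇒¬Any b∉xs (followers-⊆-tail b xs b∈)

module _ (G : Graph) where
  open Graph G renaming (sym to E-sym)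
  open import Data.List.Membership.DecPropositional (_≟_ {n}) using (_∈?_)

  ∈-allV : ∀ v → v ∈ allV G
  ∈-allV = ∈-tabulate⁺

  Unique-allV : Unique (allV G)
  Unique-allV = tabulate⁺ id

  Unique⇒length≤n : ∀ {R} → Unique R → length R ≤ n
  Unique⇒length≤n {R} u = subst (length R ≤_) (length-tabulate id) (Unique-⊆⇒length≤ u (λ {v} _ → ∈-allV v))

  deg≤degIn : ∀ v l → (∀ {w} → E v w → w ∈ l) → deg G v ≤ degIn G v l
  deg≤degIn v l N⊆l = Unique-⊆⇒length≤ (filter⁺ (E? v) Unique-allV) N⊆filter
    where
    N⊆filter : filter (E? v) (allV G) ⊆ filter (E? v) l
    N⊆filter w∈ = let vw = proj₂ (∈-filter⁻ (E? v) {xs = allV G} w∈) in ∈-filter⁺ (E? v) (N⊆l vw) vw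

  degIn-∷ʳ-self : ∀ v I → degIn G v (I ++ [ v ]) ≡ length (filter (E? v) I)
  degIn-∷ʳ-self v I = cong length (begin
    filter (E? v) (I ++ [ v ])               ≡⟨ filter-++ (E? v) I [ v ] ⟩
    filter (E? v) I ++ filter (E? v) [ v ]   ≡⟨ cong (filter (E? v) I ++_) (filter-reject (E? v) irrefl) ⟩
    filter (E? v) I ++ []                    ≡⟨ ++-identityʳ _ ⟩
    filter (E? v) I                          ∎)
    where open ≡-Reasoning

  vertices : Lollipop G → List (V G)
  vertices L = Lollipop.pre L ++ Lollipop.cyc L

  walk⇒Lollipop : ∀ B x Z → Unique (B ++ x ∷ Z) → Linked E ((B ++ x ∷ Z) ++ [ x ]) → 2 ≤ length Z →
                  Lollipop G
  walk⇒Lollipop B x Z u l 2≤∣Z∣ = record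
    { pre      = B
    ; c₁       = x
    ; rest     = Z
    ; isPathP  = Unique-++⁻ˡ (B ++ [ x ]) (subst Unique (sym (++-assoc B [ x ] Z)) u)
               , Linked-++⁻ˡ (B ++ [ x ])
                   (subst (Linked E) (sym (++-assoc B [ x ] Z)) (Linked-++⁻ˡ (B ++ x ∷ Z) l))
    ; isCycleC = s≤s 2≤∣Z∣ , Unique-++⁻ʳ B u , Linked-++⁻ʳ B (subst (Linked E) (++-assoc B (x ∷ Z) [ x ]) l)
    ; disjoint = λ v v∈B v∈xZ → Unique-++⇒Disjoint B u (v∈B , v∈xZ)
    }

  module _ (δ≥2 : MinDegAtLeast G 2) where

    chord-from-head : ∀ {z} R → (∀ {w} → E z w → w ∈ z ∷ R) →
                      ∃₂ λ y R₁ → ∃₂ λ q R₂ → R ≡ y ∷ R₁ ++ q ∷ R₂ × E z q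
    chord-from-head {z} R N⊆ with distinct-pair (filter⁺ (E? z) Unique-allV) (δ≥2 z)
    ... | a , b , a∈N , b∈N , a≢b = pick R (N⊆ za) (N⊆ zb)
      where
      za : E z a
      za = proj₂ (∈-filter⁻ (E? z) {xs = allV G} a∈N)
      zb : E z b
      zb = proj₂ (∈-filter⁻ (E? z) {xs = allV G} b∈N)
      split : ∀ {q} y R′ → q ∈ R′ → E z q →
              ∃₂ λ y′ R₁ → ∃₂ λ q′ R₂ → y ∷ R′ ≡ y′ ∷ R₁ ++ q′ ∷ R₂ × E z q′
      split y R′ q∈R′ zq with ∈-∃++ q∈R′
      ... | R₁ , R₂ , refl = y , R₁ , _ , R₂ , refl , zq
      -- Of the two distinct neighbours a, b of z on the path, one lies beyond its second vertex.
      pick : ∀ R → a ∈ z ∷ R → b ∈ z ∷ R → ∃₂ λ y R₁ → ∃₂ λ q R₂ → R ≡ y ∷ R₁ ++ q ∷ R₂ × E z q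
      pick R       (here refl)         _                   = ⊥-elim (irrefl za)
      pick R       _                   (here refl)         = ⊥-elim (irrefl zb)
      pick (y ∷ R) (there (here refl)) (there (here refl)) = ⊥-elim (a≢b refl)
      pick (y ∷ R) (there (there a∈R)) _                   = split y R a∈R za
      pick (y ∷ R) _                   (there (there b∈R)) = split y R b∈R zb

    close-at-head : ∀ {z} R → IsPath G (z ∷ R) → (∀ {w} → E z w → w ∈ z ∷ R) →
                    Σ (Lollipop G) λ L → z ∷ R ⊆ vertices L
    close-at-head {z} R (u , l) N⊆ with chord-from-head R N⊆
    ... | y , R₁ , q , R₂ , refl , zq =
      walk⇒Lollipop (reverse R₂) q (reverse X) u′ l′ ∣X∣≥2 ,
      λ v∈ → subst (_ ∈_) (reverse-++-∷ X q R₂) (reverse⁺ v∈)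
      where
      X : List (V G)
      X = z ∷ y ∷ R₁
      u′ : Unique (reverse R₂ ++ q ∷ reverse X)
      u′ = subst Unique (reverse-++-∷ X q R₂) (Unique-reverse u)
      l′ : Linked E ((reverse R₂ ++ q ∷ reverse X) ++ [ q ])
      l′ = subst (Linked E) (trans (unfold-reverse q (X ++ q ∷ R₂)) (cong (_++ [ q ]) (reverse-++-∷ X q R₂)))
                 (Linked-reverse E-sym (E-sym zq ∷ l))
      ∣X∣≥2 : 2 ≤ length (reverse X)
      ∣X∣≥2 = subst (2 ≤_) (sym (length-reverse X)) (s≤s (s≤s z≤n))

    -- The fuel bounds the number of vertices still missing from the path.
    extend : ∀ fuel z R → IsPath G (z ∷ R) → n < fuel + length (z ∷ R) →
             Σ (Lollipop G) λ L → z ∷ R ⊆ vertices L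
    extend zero z R (u , _) n< = ⊥-elim (<⇒≱ n< (Unique⇒length≤n u))
    extend (suc fuel) z R p@(u , l) n< with all? (_∈? z ∷ R) (filter (E? z) (allV G))
    ... | yes N⊆ = close-at-head R p (λ {w} zw → All.lookup N⊆ (∈-filter⁺ (E? z) (∈-allV w) zw))
    ... | no ¬N⊆ with find (¬All⇒Any¬ (_∈? z ∷ R) _ ¬N⊆)
    ... | w , w∈N , w∉ =
      map₂ (λ ⊆L v∈ → ⊆L (there v∈))
        (extend fuel w (z ∷ R) (Unique-∷ w∉ u , E-sym zw ∷ l) (subst (n <_) (sym (+-suc fuel _)) n<))
      where
      zw : E z w
      zw = proj₂ (∈-filter⁻ (E? z) {xs = allV G} w∈N)

    path⇒Lollipop : ∀ {R} → IsPath G R → R ≢ [] → Σ (Lollipop G) λ L → R ⊆ vertices L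
    path⇒Lollipop {[]}    _ R≢[] = ⊥-elim (R≢[] refl)
    path⇒Lollipop {z ∷ R} p _    = extend (suc n) z R p (s≤s (m≤m+n n _))

  ∈-vertices⁻ : ∀ L {x} → x ∈ vertices L → _∈L_ G x L
  ∈-vertices⁻ L = ∈-++⁻ (Lollipop.pre L)

  ∈-vertices⁺ : ∀ L {x} → _∈L_ G x L → x ∈ vertices L
  ∈-vertices⁺ L = [ ∈-++⁺ˡ , ∈-++⁺ʳ (Lollipop.pre L) ]′

  module _ (L : Lollipop G) (opt : Optimal G L) where

    optimal-maximal : ∀ {L′ x} → vertices L ⊆ vertices L′ → x ∈ vertices L′ → x ∈ vertices L
    optimal-maximal {L′} {x} L⊆L′ x∈L′ with x ∈? vertices L
    ... | yes x∈L = x∈L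
    ... | no  x∉L = ⊥-elim (proj₁ opt L′ (λ _ y∈ → ∈-vertices⁻ L′ (L⊆L′ (∈-vertices⁺ L y∈)))
                                         (x , ∈-vertices⁻ L′ x∈L′ , λ x∈ → x∉L (∈-vertices⁺ L x∈)))

    optimal-longest : ∀ {L′} → vertices L ⊆ vertices L′ → vertices L′ ⊆ vertices L →
                      Lollipop.cycLen L′ ≤ Lollipop.cycLen L
    optimal-longest {L′} L⊆L′ L′⊆L =
      proj₂ opt L′ (λ _ x∈ → ∈-vertices⁻ L′ (L⊆L′ (∈-vertices⁺ L x∈)))
                   (λ _ x∈ → ∈-vertices⁻ L (L′⊆L (∈-vertices⁺ L′ x∈)))

  module _ (L : Lollipop G) where
    open Lollipop L

    cyc-Unique : Unique cyc
    cyc-Unique = proj₁ (proj₂ isCycleC)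

    cyc-closed : Linked E (cyc ++ [ c₁ ])
    cyc-closed = proj₂ (proj₂ isCycleC)

    record HamiltonianPath (Q : List (V G)) : Set where
      field
        tail   : List (V G)
        starts : Q ≡ c₁ ∷ tail
        spans  : Q ↭ cyc
        linked : Linked E Q

    active⇒Hamiltonian : ∀ {Q} → ActivePath G c₁ rest Q → HamiltonianPath Q
    active⇒Hamiltonian base₁ = record
      { tail = rest ; starts = refl ; spans = ↭-refl ; linked = Linked-++⁻ˡ cyc cyc-closed }
    active⇒Hamiltonian base₂ = record
      { tail   = reverse rest
      ; starts = refl
      ; spans  = ↭-prep c₁ (↭-reverse rest)
      ; linked = Linked-++⁻ˡ (c₁ ∷ reverse rest)
                   (subst (Linked E) reverse-closed (Linked-reverse E-sym cyc-closed))
      }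
      where
      reverse-closed : reverse (cyc ++ [ c₁ ]) ≡ (c₁ ∷ reverse rest) ++ [ c₁ ]
      reverse-closed = trans (reverse-++-∷ cyc c₁ []) (cong (c₁ ∷_) (unfold-reverse c₁ rest))
    active⇒Hamiltonian (step A v w M u ap uv _)
      with active⇒Hamiltonian ap | common-head A {v} {w ∷ M ++ [ u ]} {reverse (w ∷ M ++ [ u ])}
    ... | record { starts = starts ; spans = spans ; linked = linked } | h , _ , T′ , eq , eq′ = record
      { tail   = T′
      ; starts = trans eq′ (cong (_∷ T′) (∷-injectiveˡ (trans (sym eq) starts)))
      ; spans  = ↭-trans (++⁺ˡ A (↭-prep v (↭-reverse Y))) spans
      ; linked = Linked-++-∷⁺ A (Linked-++⁻ˡ (A ++ [ v ]) (subst (Linked E) (sym (++-assoc A [ v ] Y)) linked))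
                   (subst (λ t → Linked E (v ∷ t)) (sym reverse-Y)
                     (E-sym uv ∷ subst (Linked E) reverse-Y Y-reversed))
      }
      where
      Y : List (V G)
      Y = w ∷ M ++ [ u ]
      reverse-Y : reverse Y ≡ u ∷ reverse (w ∷ M)
      reverse-Y = reverse-++-∷ (w ∷ M) u []
      Y-reversed : Linked E (reverse Y)
      Y-reversed = Linked-reverse E-sym (Linked.tail (Linked-++⁻ʳ A linked))

    ActiveEnd : V G → Set
    ActiveEnd w = Σ (List (V G)) λ Q → ActivePath G c₁ rest (Q ++ [ w ])

    follower-active : ∀ {Q I e z w} → ActivePath G c₁ rest Q → Q ≡ I ++ [ e ] → E e z →
                      Consecutive Q z w → CycEdge G c₁ rest z w → ActiveEnd w
    follower-active {I = I} {e} {z} {w} ap refl ez (D , F , eq) zw with Consecutive-∷ʳ⁻ D F I (sym eq)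
    ... | inj₁ refl        = I , ap
    ... | inj₂ (F′ , refl) =
      D ++ z ∷ reverse (F′ ++ [ e ]) ,
      subst (ActivePath G c₁ rest) rotated (step D z w F′ e (subst (ActivePath G c₁ rest) eq ap) ez zw)
      where
      rotated : D ++ z ∷ reverse (w ∷ F′ ++ [ e ]) ≡ (D ++ z ∷ reverse (F′ ++ [ e ])) ++ [ w ]
      rotated = trans (cong (λ t → D ++ z ∷ t) (unfold-reverse w (F′ ++ [ e ])))
                      (sym (++-assoc D (z ∷ reverse (F′ ++ [ e ])) [ w ]))

    module _ (δ≥2 : MinDegAtLeast G 2) (opt : Optimal G L) where

      walk-Unique : ∀ {Q} → Q ↭ cyc → Unique (pre ++ Q)
      walk-Unique Q↭C =
        Unique.++⁺ (Unique-++⁻ˡ pre (proj₁ isPathP)) (Unique-resp-↭ (↭-sym Q↭C) cyc-Unique)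
                   (λ (v∈pre , v∈Q) → disjoint _ v∈pre (∈-resp-↭ Q↭C v∈Q))

      walk-linked : ∀ {Q′ x} → Linked E ((c₁ ∷ Q′) ++ [ x ]) → Linked E ((pre ++ c₁ ∷ Q′) ++ [ x ])
      walk-linked {Q′} {x} l =
        subst (Linked E) (sym (++-assoc pre (c₁ ∷ Q′) [ x ])) (Linked-++-∷⁺ pre (proj₂ isPathP) l)

      ∈-walk⁻ : ∀ {Q v} → Q ↭ cyc → v ∈ pre ++ Q → v ∈ vertices L
      ∈-walk⁻ Q↭C = ∈-resp-↭ (++⁺ˡ pre Q↭C)

      ∈-walk⁺ : ∀ {Q v} → Q ↭ cyc → v ∈ vertices L → v ∈ pre ++ Q
      ∈-walk⁺ Q↭C = ∈-resp-↭ (↭-sym (++⁺ˡ pre Q↭C))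

      -- If x ∈ pre, the walk pre Q x closes a cycle through x on the vertices of L that is longer than C.
      end-neighbour-∉pre : ∀ {Q′ x} → (c₁ ∷ Q′) ↭ cyc → Linked E ((c₁ ∷ Q′) ++ [ x ]) → x ∉ pre
      end-neighbour-∉pre {Q′} {x} Q↭C l x∈pre with ∈-∃++ x∈pre
      ... | B , B₂ , pre≡ = <⇒≱ longer (optimal-longest L opt {L′} L⊆L′ L′⊆L)
        where
        Z : List (V G)
        Z = B₂ ++ c₁ ∷ Q′
        walk≡ : pre ++ c₁ ∷ Q′ ≡ B ++ x ∷ Z
        walk≡ = trans (cong (_++ c₁ ∷ Q′) pre≡) (++-assoc B (x ∷ B₂) (c₁ ∷ Q′))
        ∣C∣≤∣Z∣ : length cyc ≤ length Z
        ∣C∣≤∣Z∣ = subst (_≤ length Z) (↭-length Q↭C)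
                   (subst (length (c₁ ∷ Q′) ≤_) (sym (length-++ B₂)) (m≤n+m _ _))
        L′ : Lollipop G
        L′ = walk⇒Lollipop B x Z (subst Unique walk≡ (walk-Unique Q↭C))
               (subst (λ W → Linked E (W ++ [ x ])) walk≡ (walk-linked l))
               (≤-trans (n≤1+n 2) (≤-trans (proj₁ isCycleC) ∣C∣≤∣Z∣))
        L⊆L′ : vertices L ⊆ vertices L′
        L⊆L′ v∈ = subst (_ ∈_) walk≡ (∈-walk⁺ Q↭C v∈)
        L′⊆L : vertices L′ ⊆ vertices L
        L′⊆L v∈ = ∈-walk⁻ Q↭C (subst (_ ∈_) (sym walk≡) v∈)
        longer : cycLen < Lollipop.cycLen L′
        longer = s≤s ∣C∣≤∣Z∣

      -- If x ∉ pre Q, the walk pre Q x is a path through all of L and beyond it.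
      end-neighbour-∈walk : ∀ {Q′ x} → (c₁ ∷ Q′) ↭ cyc → Linked E ((c₁ ∷ Q′) ++ [ x ]) → x ∈ pre ++ c₁ ∷ Q′
      end-neighbour-∈walk {Q′} {x} Q↭C l with x ∈? pre ++ c₁ ∷ Q′
      ... | yes x∈W = x∈W
      ... | no  x∉W = ⊥-elim (x∉W (∈-walk⁺ Q↭C (optimal-maximal L opt {L′} L⊆L′ (R⊆L′ (∈-++⁺ʳ _ (here refl))))))
        where
        R : List (V G)
        R = (pre ++ c₁ ∷ Q′) ++ [ x ]
        R-path : IsPath G R
        R-path = Unique.++⁺ (walk-Unique Q↭C) ([] ∷ []) (λ { (v∈W , here refl) → x∉W v∈W }) , walk-linked l
        extension : Σ (Lollipop G) λ L′ → R ⊆ vertices L′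
        extension = path⇒Lollipop δ≥2 R-path (λ R≡[] → case ++-conicalʳ _ [ x ] R≡[] of λ ())
        L′ : Lollipop G
        L′ = proj₁ extension
        R⊆L′ : R ⊆ vertices L′
        R⊆L′ = proj₂ extension
        L⊆L′ : vertices L ⊆ vertices L′
        L⊆L′ v∈ = R⊆L′ (∈-++⁺ˡ (∈-walk⁺ Q↭C v∈))

      end-neighbour-∈C : ∀ {Q I e x} → HamiltonianPath Q → Q ≡ I ++ [ e ] → E e x → x ∈ cyc
      end-neighbour-∈C {I = I} {x = x} record { tail = Q′ ; starts = refl ; spans = Q↭C ; linked = l } Q≡ ex =
        [ (λ x∈pre → ⊥-elim (end-neighbour-∉pre Q↭C lx x∈pre)) , ∈-resp-↭ Q↭C ]′
          (∈-++⁻ pre (end-neighbour-∈walk Q↭C lx))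
        where
        lx : Linked E ((c₁ ∷ Q′) ++ [ x ])
        lx = subst (λ Q → Linked E (Q ++ [ x ])) (sym Q≡) (Linked-∷ʳ I (subst (Linked E) Q≡ l) ex)

module _ (G : Graph) (k : ℕ) (k≥2 : 2 ≤ k) (δ≥k : MinDegAtLeast G k) (L : Lollipop G) (opt : Optimal G L) where
  open Graph G renaming (sym to E-sym)
  open Lollipop L

  δ≥2 : MinDegAtLeast G 2
  δ≥2 v = ≤-trans k≥2 (δ≥k v)

  ActiveSet : List (V G) → Set
  ActiveSet S = Unique S × All (_∈ cyc) S × All (ActiveVertex G c₁ rest) S

  cyc-edge : ∀ {z w} → Consecutive cyc z w → CycEdge G c₁ rest z w
  cyc-edge = inj₁ ∘ Consecutive-++⁺ʳ [ c₁ ]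

  reversed-cyc-edge : ∀ {z w} → Consecutive cyc w z → CycEdge G c₁ rest z w
  reversed-cyc-edge = inj₂ ∘ Consecutive-++⁺ʳ [ c₁ ]

  -- Rotating Q at a neighbour z of its end e makes the successor of z on Q the end of an active path (when that
  -- pair is an edge of C); e has at least k neighbours, all on C and hence on Q.
  end-followers-active : ∀ {Q I e} → ActivePath G c₁ rest Q → Q ≡ I ++ [ e ] →
                         (∀ {z w} → Consecutive Q z w → CycEdge G c₁ rest z w ⊎ ActiveEnd G L w) →
                         k ≤ length (followers (E? e) Q) × ActiveSet (followers (E? e) Q)
  end-followers-active {Q} {I} {e} ap Q≡ junction with active⇒Hamiltonian G L ap
  ... | ham@record { tail = Q′ ; starts = refl ; spans = Q↭C } =
    k≤∣F∣ , followers-Unique (E? e) Q Q-Unique , All.tabulate (∈-resp-↭ Q↭C ∘ there ∘ ∈Q′) , All.tabulate active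
    where
    F : List (V G)
    F = followers (E? e) Q
    Q-Unique : Unique Q
    Q-Unique = Unique-resp-↭ (↭-sym Q↭C) (cyc-Unique G L)
    ∈Q′ : ∀ {w} → w ∈ F → w ∈ Q′
    ∈Q′ = followers-⊆-tail (E? e) c₁ Q′
    active : ∀ {w} → w ∈ F → ActiveVertex G c₁ rest w
    active w∈ with ∈-followers⁻ (E? e) Q w∈
    ... | z , ez , c =
      (λ { refl → Unique[x∷xs]⇒x∉xs Q-Unique (∈Q′ w∈) }) ,
      [ follower-active G L ap Q≡ ez c , id ]′ (junction c)
    k≤∣F∣ : k ≤ length F
    k≤∣F∣ = begin
      k                                      ≤⟨ δ≥k e ⟩
      deg G e                                ≤⟨ deg≤degIn G e Q N⊆Q ⟩
      degIn G e Q                            ≡⟨ cong (degIn G e) Q≡ ⟩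
      degIn G e (I ++ [ e ])                 ≡⟨ degIn-∷ʳ-self G e I ⟩
      length (filter (E? e) I)               ≡⟨ sym (length-followers (E? e) I e) ⟩
      length (followers (E? e) (I ++ [ e ])) ≡⟨ cong (length ∘ followers (E? e)) (sym Q≡) ⟩
      length F                               ∎
      where
      open ≤-Reasoning
      N⊆Q : ∀ {x} → E e x → x ∈ Q
      N⊆Q = ∈-resp-↭ (↭-sym Q↭C) ∘ end-neighbour-∈C G L δ≥2 opt ham Q≡

  cₜ-split : ∃₂ λ init cₜ → cyc ≡ init ++ [ cₜ ]
  cₜ-split = ∷-unsnoc c₁ rest

  init : List (V G)
  init = proj₁ cₜ-split

  cₜ : V G
  cₜ = proj₁ (proj₂ cₜ-split)

  cyc≡init∷ʳcₜ : cyc ≡ init ++ [ cₜ ]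
  cyc≡init∷ʳcₜ = proj₂ (proj₂ cₜ-split)

  cₜ-active-end : ActiveEnd G L cₜ
  cₜ-active-end = init , subst (ActivePath G c₁ rest) cyc≡init∷ʳcₜ base₁

  cₜc₁ : E cₜ c₁
  cₜc₁ = Linked.head (Linked-++⁻ʳ init (subst (Linked E) closing (cyc-closed G L)))
    where
    closing : cyc ++ [ c₁ ] ≡ init ++ cₜ ∷ [ c₁ ]
    closing = trans (cong (_++ [ c₁ ]) cyc≡init∷ʳcₜ) (++-assoc init [ cₜ ] [ c₁ ])

  F₁ : List (V G)
  F₁ = followers (E? cₜ) cyc

  F₁-properties : k ≤ length F₁ × ActiveSet F₁
  F₁-properties = end-followers-active base₁ cyc≡init∷ʳcₜ (inj₁ ∘ cyc-edge)

  at-least-k-active : AtLeastActive G c₁ rest k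
  at-least-k-active = F₁ , F₁-properties

  nonadjacent-follower : degIn G c₁ cyc < k → ∃ λ y → y ∈ F₁ × ¬ E c₁ y
  nonadjacent-follower d<k with all? (E? c₁) F₁
  ... | no ¬all = find (¬All⇒Any¬ (E? c₁) F₁ ¬all)
  ... | yes all-adjacent =
    let k≤∣F₁∣ , F₁-Unique , F₁⊆C , _ = F₁-properties
    in ⊥-elim (<⇒≱ d<k (≤-trans k≤∣F₁∣ (Unique-⊆⇒length≤ F₁-Unique
         (λ y∈ → ∈-filter⁺ (E? c₁) (All.lookup F₁⊆C y∈) (All.lookup all-adjacent y∈)))))

  -- y is neither c₂ (adjacent to c₁ on C) nor cₜ (adjacent to c₁ by the closing edge of C).
  split-at-follower : ∀ {y} → y ∈ F₁ → ¬ E c₁ y →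
                      ∃₂ λ A x → ∃ λ M → rest ≡ A ++ x ∷ y ∷ M ++ [ cₜ ] × E cₜ x
  split-at-follower y∈ ¬c₁y with ∈-followers⁻ (E? cₜ) cyc y∈
  ... | x , cₜx , [] , F , eq =
    ⊥-elim (¬c₁y (subst (λ v → E v _) (sym (∷-injectiveˡ eq))
                   (Linked.head (subst (Linked E) eq (Linked-++⁻ˡ cyc (cyc-closed G L))))))
  ... | x , cₜx , d ∷ A , F , eq with Consecutive-∷ʳ⁻ (d ∷ A) F init (trans (sym eq) cyc≡init∷ʳcₜ)
  ...   | inj₁ refl       = ⊥-elim (¬c₁y (E-sym cₜc₁))
  ...   | inj₂ (M , refl) = A , x , M , ∷-injectiveʳ eq , cₜx

  module Rotation (A : List (V G)) (x y : V G) (M : List (V G)) (rest≡ : rest ≡ A ++ x ∷ y ∷ M ++ [ cₜ ])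
                  (cₜx : E cₜ x) (¬c₁y : ¬ E c₁ y) where

    X : List (V G)
    X = c₁ ∷ A ++ [ x ]

    Y : List (V G)
    Y = y ∷ M

    cyc≡X++Y∷ʳcₜ : cyc ≡ X ++ Y ++ [ cₜ ]
    cyc≡X++Y∷ʳcₜ = cong (c₁ ∷_) (trans rest≡ (sym (++-assoc A [ x ] _)))

    Q : List (V G)
    Q = c₁ ∷ A ++ x ∷ reverse (Y ++ [ cₜ ])

    Q-active : ActivePath G c₁ rest Q
    Q-active = step (c₁ ∷ A) x y M cₜ (subst (ActivePath G c₁ rest) (cong (c₁ ∷_) rest≡) base₁) cₜx
                 (cyc-edge (c₁ ∷ A , M ++ [ cₜ ] , cong (c₁ ∷_) rest≡))

    Q≡…∷ʳy : Q ≡ (c₁ ∷ A ++ x ∷ reverse (M ++ [ cₜ ])) ++ [ y ]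
    Q≡…∷ʳy = trans (cong (λ t → c₁ ∷ A ++ x ∷ t) (unfold-reverse y (M ++ [ cₜ ])))
                   (cong (c₁ ∷_) (sym (++-assoc A (x ∷ reverse (M ++ [ cₜ ])) [ y ])))

    Q≡X++cₜ∷… : Q ≡ X ++ cₜ ∷ reverse Y
    Q≡X++cₜ∷… = trans (cong (λ t → c₁ ∷ A ++ x ∷ t) (reverse-++-∷ Y cₜ []))
                      (cong (c₁ ∷_) (sym (++-assoc A [ x ] _)))

    -- Every pair of consecutive vertices of Q is an edge of C, except x cₜ where Q was rotated.
    junction : ∀ {z w} → Consecutive Q z w → CycEdge G c₁ rest z w ⊎ ActiveEnd G L w
    junction {z} {w} c with Consecutive-++-∷⁻ X (subst (λ P → Consecutive P z w) Q≡X++cₜ∷… c)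
    ... | inj₁ c′          =
      inj₁ (cyc-edge (subst (λ P → Consecutive P z w) (sym cyc≡X++Y∷ʳcₜ) (Consecutive-++⁺ʳ (Y ++ [ cₜ ]) c′)))
    ... | inj₂ (inj₁ refl) = inj₂ cₜ-active-end
    ... | inj₂ (inj₂ c′)   = inj₁ (reversed-cyc-edge (subst (λ P → Consecutive P w z) (sym cyc≡X++Y∷ʳcₜ)
                               (Consecutive-++⁺ˡ X (Consecutive-reverse⁻ (Y ++ [ cₜ ])
                                 (subst (λ P → Consecutive P z w) (sym (reverse-++-∷ Y cₜ [])) c′)))))

    F₂ : List (V G)
    F₂ = followers (E? y) Q

    F₂-properties : k ≤ length F₂ × ActiveSet F₂
    F₂-properties = end-followers-active {I = c₁ ∷ A ++ x ∷ reverse (M ++ [ cₜ ])} Q-active Q≡…∷ʳy junction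

    -- c₂ is the end of the active path c₁ cₜ … c₂, and it follows c₁ on Q, which is not adjacent to y.
    c₂∷F₂-active : AtLeastActive G c₁ rest (suc k)
    c₂∷F₂-active with common-head A {x} {Y ++ [ cₜ ]} {reverse (Y ++ [ cₜ ])} | F₂-properties
    ... | c₂ , T , T′ , rest≡′ , Q≡′ | k≤∣F₂∣ , F₂-Unique , F₂⊆C , F₂-active =
      c₂ ∷ F₂ , s≤s k≤∣F₂∣ , Unique-∷ c₂∉F₂ F₂-Unique , c₂∈C ∷ F₂⊆C , (c₂≢c₁ , c₂-active-end) ∷ F₂-active
      where
      rest≡c₂∷T : rest ≡ c₂ ∷ T
      rest≡c₂∷T = trans rest≡ rest≡′
      c₂∈rest : c₂ ∈ rest
      c₂∈rest = subst (c₂ ∈_) (sym rest≡c₂∷T) (here refl)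
      c₂∈C : c₂ ∈ cyc
      c₂∈C = there c₂∈rest
      c₂≢c₁ : c₂ ≢ c₁
      c₂≢c₁ refl = Unique[x∷xs]⇒x∉xs (cyc-Unique G L) c₂∈rest
      c₂-active-end : ActiveEnd G L c₂
      c₂-active-end = c₁ ∷ reverse T ,
        subst (ActivePath G c₁ rest) (cong (c₁ ∷_) (trans (cong reverse rest≡c₂∷T) (unfold-reverse c₂ T))) base₂
      Q≡c₁∷c₂∷T′ : Q ≡ c₁ ∷ c₂ ∷ T′
      Q≡c₁∷c₂∷T′ = cong (c₁ ∷_) Q≡′
      Q-Unique : Unique Q
      Q-Unique = Unique-resp-↭ (↭-sym (HamiltonianPath.spans (active⇒Hamiltonian G L Q-active)))
                               (cyc-Unique G L)
      c₂∉F₂ : c₂ ∉ F₂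
      c₂∉F₂ c₂∈ = ∉-followers (E? y) (¬c₁y ∘ E-sym) (subst Unique Q≡c₁∷c₂∷T′ Q-Unique)
                                (subst (λ P → c₂ ∈ followers (E? y) P) Q≡c₁∷c₂∷T′ c₂∈)

  at-least-k+1-active : degIn G c₁ cyc < k → AtLeastActive G c₁ rest (suc k)
  at-least-k+1-active d<k with nonadjacent-follower d<k
  ... | y , y∈F₁ , ¬c₁y with split-at-follower y∈F₁ ¬c₁y
  ... | A , x , M , rest≡ , cₜx = Rotation.c₂∷F₂-active A x y M rest≡ cₜx ¬c₁y

lemma4 : (G : Graph) (k : ℕ) → 2 ≤ k → MinDegAtLeast G k →
    (L : Lollipop G) → Optimal G L →
    AtLeastActive G (Lollipop.c₁ L) (Lollipop.rest L) k
    × (degIn G (Lollipop.c₁ L) (Lollipop.cyc L) < k →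
       AtLeastActive G (Lollipop.c₁ L) (Lollipop.rest L) (suc k))
lemma4 G k k≥2 δ≥k L opt = at-least-k-active G k k≥2 δ≥k L opt , at-least-k+1-active G k k≥2 δ≥k L opt
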